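{- For every triangle-free graph $G$, we have $\mathit{eq}(L(G)) = \sigma(G)$.
   Context: An equivalence graph is a disjoint union of cliques. The equivalence number $\mathit{eq}(H)$ of a graph $H$ is the minimum number of subgraphs of $H$, each an equivalence graph, whose union covers all edges of $H$. $L(G)$ is the line graph of $G$ (vertices are the edges of $G$, adjacent iff they share an endpoint). An orientation covering of $G$ is a set of orientations $\overrightarrow{G_1},\dots,\overrightarrow{G_k}$ of $G$ such that for every vertex $u$ and any two distinct neighbors $v,w$ of $u$, some $\overrightarrow{G_i}$ contains both arcs $\overrightarrow{uv}$ and $\overrightarrow{uw}$. $\sigma(G)$ is the minimum size of an orientation covering of $G$. -}

module Defs where

open import Data.Nat using (ℕ; _≤_)
open import Data.Fin using (Fin)
import Data.Fin as F
open import Data.Bool using (Bool; T)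
open import Data.Product using (Σ; _×_; _,_; ∃-syntax; proj₁; proj₂)
open import Data.Sum using (_⊎_)
open import Data.Empty using (⊥)
open import Relation.Nullary using (¬_)
open import Relation.Binary.PropositionalEquality using (_≡_; _≢_)

record Graph (n : ℕ) : Set where
  field
    adj   : Fin n → Fin n → Bool
    sym   : ∀ u v → T (adj u v) → T (adj v u)
    irrefl : ∀ u → ¬ T (adj u u)

open Graph public

Adj : ∀ {n} → Graph n → Fin n → Fin n → Set
Adj G u v = T (adj G u v)

TriangleFree : ∀ {n} → Graph n → Set
TriangleFree G = ∀ u v w → Adj G u v → Adj G v w → Adj G u w → ⊥

record SGraph (V : Set) : Set₁ where
  field
    E : V → V → Set

open SGraph public

-- Edges of G: pairs (u , v) with u < v and u ~ v (each edge listed once).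
Edge : ∀ {n} → Graph n → Set
Edge {n} G = Σ (Fin n × Fin n) λ p → (proj₁ p F.< proj₂ p) × Adj G (proj₁ p) (proj₂ p)

src tgt : ∀ {n} {G : Graph n} → Edge G → Fin n
src e = proj₁ (proj₁ e)
tgt e = proj₂ (proj₁ e)

ShareEndpoint : ∀ {n} {G : Graph n} → Edge G → Edge G → Set
ShareEndpoint {G = G} e f =
  (src {G = G} e ≡ src {G = G} f) ⊎ (src {G = G} e ≡ tgt {G = G} f) ⊎
  (tgt {G = G} e ≡ src {G = G} f) ⊎ (tgt {G = G} e ≡ tgt {G = G} f)

LineGraph : ∀ {n} (G : Graph n) → SGraph (Edge G)
LineGraph G = record { E = λ e f → (e ≢ f) × ShareEndpoint {G = G} e f }

-- F is (the edge relation of) a subgraph of H which is an equivalence graph,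
-- i.e. a disjoint union of cliques: symmetric, and transitive on distinct
-- vertices.
IsEquivSubgraph : ∀ {V} → SGraph V → (V → V → Set) → Set
IsEquivSubgraph {V} H R =
  (∀ u v → R u v → E H u v) ×
  (∀ u v → R u v → R v u) ×
  (∀ u v w → R u v → R v w → u ≢ w → R u w)

HasEqCover : ∀ {V} → SGraph V → ℕ → Set₁
HasEqCover {V} H k =
  Σ (Fin k → V → V → Set) λ R →
    (∀ i → IsEquivSubgraph H (R i)) ×
    (∀ u v → E H u v → ∃[ i ] R i u v)

IsEqNumber : ∀ {V} → SGraph V → ℕ → Set₁
IsEqNumber H m = HasEqCover H m × (∀ k → HasEqCover H k → m ≤ k)

IsOrientation : ∀ {n} → Graph n → (Fin n → Fin n → Set) → Set
IsOrientation G D =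
  (∀ u v → D u v → Adj G u v) ×
  (∀ u v → Adj G u v → D u v ⊎ D v u) ×
  (∀ u v → D u v → D v u → ⊥)

HasOrientationCover : ∀ {n} → Graph n → ℕ → Set₁
HasOrientationCover {n} G k =
  Σ (Fin k → Fin n → Fin n → Set) λ D →
    (∀ i → IsOrientation G (D i)) ×
    (∀ u v w → Adj G u v → Adj G u w → v ≢ w → ∃[ i ] (D i u v × D i u w))

IsSigma : ∀ {n} → Graph n → ℕ → Set₁
IsSigma G m = HasOrientationCover G m × (∀ k → HasOrientationCover G k → m ≤ k)

module Submission where

-- Both quantities are minima, so it suffices to show that G has an
-- orientation covering of size k exactly when L(G) has an equivalence
-- covering of size k (lemma minimum-transfer).
--
-- Orientations to cliques (any graph): each orientation D of G yields the
--   equivalence subgraph Star D of L(G), relating edges that leave a common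
--   vertex.  Its cliques are the out-stars of D, because an edge has only one
--   tail, and the covering condition on the orientations says exactly that
--   every pair of adjacent edges lies in some out-star.
-- Cliques to orientations (triangle-free G): from a class R of an
--   equivalence covering we orient each edge away from the endpoint at which
--   R meets it.  In a triangle-free graph a clique of L(G) containing e meets
--   e at one endpoint only (class-meets-one-end), so this is consistent; a
--   decidable refinement of the covering makes the choice computable.

open import Defs hiding (sym)
open import Data.Nat using (ℕ; _≤_)
import Data.Nat.Properties as ℕ
open import Data.Fin using (Fin)
import Data.Fin as F
open import Data.Fin.Properties using (_≟_; _<?_; <-cmp; any?)
open import Data.Bool.Properties using (T-irrelevant)
open import Data.Maybe using (Maybe; just; nothing)
open import Data.Maybe.Properties using () renaming (≡-dec to ≡-dec-Maybe)
open import Data.Product using (Σ; _×_; _,_; ∃-syntax; proj₁; proj₂)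
open import Data.Sum using (_⊎_; inj₁; inj₂)
open import Data.Empty using (⊥; ⊥-elim)
open import Function using (_∘_)
open import Relation.Nullary using (¬_; Dec; yes; no)
open import Relation.Nullary.Decidable using (_×-dec_; _⊎-dec_; ¬?; map′; T?)
open import Relation.Binary.Definitions using (tri<; tri≈; tri>)
open import Relation.Binary.PropositionalEquality

minimum-transfer : {P Q : ℕ → Set₁} → (∀ k → P k → Q k) → (∀ k → Q k → P k) →
                   ∀ m → P m × (∀ k → P k → m ≤ k) → Q m × (∀ k → Q k → m ≤ k)
minimum-transfer P⇒Q Q⇒P m (pm , least) = P⇒Q m pm , λ k qk → least k (Q⇒P k qk)

module Edges {n : ℕ} (G : Graph n) where

  Ed : Set
  Ed = Edge G

  L : SGraph Ed
  L = LineGraph G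

  s t : Ed → Fin n
  s e = src {G = G} e
  t e = tgt {G = G} e

  s-adj-t : (e : Ed) → Adj G (s e) (t e)
  s-adj-t e = proj₂ (proj₂ e)

  s≢t : (e : Ed) → s e ≢ t e
  s≢t e eq = ℕ.<-irrefl (cong F.toℕ eq) (proj₁ (proj₂ e))

  adj⇒≢ : ∀ {a b} → Adj G a b → a ≢ b
  adj⇒≢ {a} ab refl = irrefl G a ab

  -- The order and adjacency witnesses are proof-irrelevant, so an edge is
  -- determined by its two endpoints.
  edge-≡ : ∀ {e f} → s e ≡ s f → t e ≡ t f → e ≡ f
  edge-≡ {((a , b) , lt , ab)} {((.a , .b) , lt′ , ab′)} refl refl =
    cong₂ (λ l d → ((a , b) , l , d)) (ℕ.<-irrelevant lt lt′) (T-irrelevant ab ab′)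

  _≟ₑ_ : (e f : Ed) → Dec (e ≡ f)
  e ≟ₑ f with s e ≟ s f | t e ≟ t f
  ... | yes p | yes q = yes (edge-≡ p q)
  ... | no ¬p | _     = no (¬p ∘ cong s)
  ... | yes _ | no ¬q = no (¬q ∘ cong t)

  data _∈ₑ_ (x : Fin n) (e : Ed) : Set where
    at-s : x ≡ s e → x ∈ₑ e
    at-t : x ≡ t e → x ∈ₑ e

  endpoints : ∀ {a b e} → a ∈ₑ e → b ∈ₑ e → a ≢ b →
              (a ≡ s e × b ≡ t e) ⊎ (a ≡ t e × b ≡ s e)
  endpoints (at-s p) (at-s q) a≢b = ⊥-elim (a≢b (trans p (sym q)))
  endpoints (at-s p) (at-t q) _   = inj₁ (p , q)
  endpoints (at-t p) (at-s q) _   = inj₂ (p , q)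
  endpoints (at-t p) (at-t q) a≢b = ⊥-elim (a≢b (trans p (sym q)))

  at-most-two : ∀ {a b c e} → a ∈ₑ e → b ∈ₑ e → c ∈ₑ e → a ≢ b → a ≢ c → b ≡ c
  at-most-two {e = e} ae be ce a≢b a≢c with endpoints ae be a≢b | endpoints ae ce a≢c
  ... | inj₁ (_ , q) | inj₁ (_ , r) = trans q (sym r)
  ... | inj₂ (_ , q) | inj₂ (_ , r) = trans q (sym r)
  ... | inj₁ (p , _) | inj₂ (r , _) = ⊥-elim (s≢t e (trans (sym p) r))
  ... | inj₂ (p , _) | inj₁ (r , _) = ⊥-elim (s≢t e (trans (sym r) p))

  edge-determined : ∀ {a b e f} → a ∈ₑ e → b ∈ₑ e → a ≢ b → a ∈ₑ f → b ∈ₑ f → e ≡ f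
  edge-determined {e = e} {f} ae be a≢b af bf with endpoints ae be a≢b | endpoints af bf a≢b
  ... | inj₁ (p , q) | inj₁ (p′ , q′) = edge-≡ (trans (sym p) p′) (trans (sym q) q′)
  ... | inj₂ (p , q) | inj₂ (p′ , q′) = edge-≡ (trans (sym q) q′) (trans (sym p) p′)
  ... | inj₁ (p , q) | inj₂ (p′ , q′) =
    ⊥-elim (ℕ.<-asym (subst₂ F._<_ (sym p) (sym q) (proj₁ (proj₂ e)))
                     (subst₂ F._<_ (sym q′) (sym p′) (proj₁ (proj₂ f))))
  ... | inj₂ (p , q) | inj₁ (p′ , q′) =
    ⊥-elim (ℕ.<-asym (subst₂ F._<_ (sym p′) (sym q′) (proj₁ (proj₂ f)))
                     (subst₂ F._<_ (sym q) (sym p) (proj₁ (proj₂ e))))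

  fan-distinct : ∀ {u v w e f} → u ∈ₑ e → v ∈ₑ e → u ∈ₑ f → w ∈ₑ f →
                 u ≢ v → u ≢ w → v ≢ w → e ≢ f
  fan-distinct ue ve uf wf u≢v u≢w v≢w refl = v≢w (at-most-two uf ve wf u≢v u≢w)

  endpoints-adjacent : ∀ {a b e} → a ∈ₑ e → b ∈ₑ e → a ≢ b → Adj G a b
  endpoints-adjacent {e = e} ae be a≢b with endpoints ae be a≢b
  ... | inj₁ (refl , refl) = s-adj-t e
  ... | inj₂ (refl , refl) = Graph.sym G _ _ (s-adj-t e)

  edge-between : ∀ {a b} → Adj G a b → Σ Ed λ e → a ∈ₑ e × b ∈ₑ e
  edge-between {a} {b} ab with <-cmp a b
  ... | tri< a<b _ _ = ((a , b) , a<b , ab) , at-s refl , at-t refl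
  ... | tri≈ _ a≡b _ = ⊥-elim (adj⇒≢ ab a≡b)
  ... | tri> _ _ b<a = ((b , a) , b<a , Graph.sym G a b ab) , at-t refl , at-s refl

  other-endpoint : ∀ {z e} → z ∈ₑ e → Σ (Fin n) λ x → x ∈ₑ e × z ≢ x
  other-endpoint {e = e} (at-s p) = t e , at-t refl , λ q → s≢t e (trans (sym p) q)
  other-endpoint {e = e} (at-t p) = s e , at-s refl , λ q → s≢t e (trans (sym q) p)

  share⇒common : ∀ {e f} → ShareEndpoint {G = G} e f → Σ (Fin n) λ z → z ∈ₑ e × z ∈ₑ f
  share⇒common {e} (inj₁ p)                = s e , at-s refl , at-s p
  share⇒common {e} (inj₂ (inj₁ p))         = s e , at-s refl , at-t p
  share⇒common {e} (inj₂ (inj₂ (inj₁ p)))  = t e , at-t refl , at-s p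
  share⇒common {e} (inj₂ (inj₂ (inj₂ p)))  = t e , at-t refl , at-t p

  common⇒share : ∀ {z e f} → z ∈ₑ e → z ∈ₑ f → ShareEndpoint {G = G} e f
  common⇒share (at-s p) (at-s q) = inj₁ (trans (sym p) q)
  common⇒share (at-s p) (at-t q) = inj₂ (inj₁ (trans (sym p) q))
  common⇒share (at-t p) (at-s q) = inj₂ (inj₂ (inj₁ (trans (sym p) q)))
  common⇒share (at-t p) (at-t q) = inj₂ (inj₂ (inj₂ (trans (sym p) q)))

  -- Decidability, needed to make the orientations of the (⇐) direction total.
  _∈ₑ?_ : (x : Fin n) (e : Ed) → Dec (x ∈ₑ e)
  x ∈ₑ? e with x ≟ s e | x ≟ t e
  ... | yes p | _     = yes (at-s p)
  ... | no _  | yes q = yes (at-t q)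
  ... | no ¬p | no ¬q = no λ { (at-s p) → ¬p p ; (at-t q) → ¬q q }

  L-adjacent? : ∀ e f → Dec (E L e f)
  L-adjacent? e f =
    ¬? (e ≟ₑ f) ×-dec ((s e ≟ s f) ⊎-dec (s e ≟ t f) ⊎-dec (t e ≟ s f) ⊎-dec (t e ≟ t f))

  any-edge? : (Q : Ed → Set) → (∀ e → Dec (Q e)) → Dec (Σ Ed Q)
  any-edge? Q Q? = map′ pack unpack (any? λ a → any? λ b → at a b)
    where
      At : Fin n → Fin n → Set
      At a b = Σ (a F.< b × Adj G a b) λ p → Q ((a , b) , p)
      at : ∀ a b → Dec (At a b)
      at a b with a <? b | T? (adj G a b)
      ... | no a≮b | _      = no (a≮b ∘ proj₁ ∘ proj₁)
      ... | yes _  | no ¬ab = no (¬ab ∘ proj₂ ∘ proj₁)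
      ... | yes a<b | yes ab =
        map′ ((a<b , ab) ,_) (λ { (_ , q) → subst Q (edge-≡ refl refl) q }) (Q? ((a , b) , a<b , ab))
      pack : (∃[ a ] ∃[ b ] At a b) → Σ Ed Q
      pack (a , b , p , q) = ((a , b) , p) , q
      unpack : Σ Ed Q → ∃[ a ] ∃[ b ] At a b
      unpack (((a , b) , p) , q) = a , b , p , q

module OutStars {n : ℕ} (G : Graph n) where
  open Edges G

  Leaves : (Fin n → Fin n → Set) → Fin n → Ed → Set
  Leaves D u e = Σ (Fin n) λ v → u ∈ₑ e × v ∈ₑ e × D u v

  -- An edge has a single tail: two distinct tails would orient it both ways.
  tail-unique : ∀ {D u u′ e} → IsOrientation G D → Leaves D u e → Leaves D u′ e → u ≡ u′
  tail-unique {D} {u} {u′} (arcs-are-edges , _ , antisymmetric)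
              (v , ue , ve , uv) (v′ , u′e , v′e , u′v′) with u ≟ u′
  ... | yes u≡u′ = u≡u′
  ... | no u≢u′ = ⊥-elim (antisymmetric u u′ (subst (D u) (sym u′≡v) uv)
                                             (subst (D u′) (sym u≡v′) u′v′))
    where
      u′≡v : u′ ≡ v
      u′≡v = at-most-two ue u′e ve u≢u′ (adj⇒≢ (arcs-are-edges _ _ uv))
      u≡v′ : u ≡ v′
      u≡v′ = at-most-two u′e ue v′e (u≢u′ ∘ sym) (adj⇒≢ (arcs-are-edges _ _ u′v′))

  Star : (Fin n → Fin n → Set) → Ed → Ed → Set
  Star D e f = e ≢ f × Σ (Fin n) λ u → Leaves D u e × Leaves D u f

  star-equivalence : ∀ {D} → IsOrientation G D → IsEquivSubgraph L (Star D)
  star-equivalence {D} D-orients = in-L , symmetric , transitive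
    where
      in-L : ∀ e f → Star D e f → E L e f
      in-L _ _ (e≢f , _ , (_ , ue , _) , (_ , uf , _)) = e≢f , common⇒share ue uf
      symmetric : ∀ e f → Star D e f → Star D f e
      symmetric _ _ (e≢f , u , ue , uf) = e≢f ∘ sym , u , uf , ue
      transitive : ∀ e f g → Star D e f → Star D f g → e ≢ g → Star D e g
      transitive _ _ g (_ , u , ue , uf) (_ , u′ , u′f , u′g) e≢g =
        e≢g , u , ue , subst (λ x → Leaves D x g) (sym (tail-unique D-orients uf u′f)) u′g

  star-cover : ∀ {k} (D : Fin k → Fin n → Fin n → Set) →
               (∀ u v w → Adj G u v → Adj G u w → v ≢ w → ∃[ i ] (D i u v × D i u w)) →
               ∀ e f → E L e f → ∃[ i ] Star (D i) e f
  star-cover D covers e f (e≢f , shared)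
    with share⇒common shared
  ... | z , ze , zf with other-endpoint ze | other-endpoint zf
  ...   | x , xe , z≢x | y , yf , z≢y
    with covers z x y (endpoints-adjacent ze xe z≢x) (endpoints-adjacent zf yf z≢y)
                      (λ { refl → e≢f (edge-determined ze xe z≢x zf yf) })
  ...   | i , zx , zy = i , e≢f , z , (x , ze , xe , zx) , (y , zf , yf , zy)

orientation-cover⇒eq-cover : ∀ {n} (G : Graph n) {k} →
                             HasOrientationCover G k → HasEqCover (LineGraph G) k
orientation-cover⇒eq-cover G (D , orients , covers) =
  (λ i → Star (D i)) , (λ i → star-equivalence (orients i)) , star-cover D covers
  where open OutStars G

module ChosenOrientation {n : ℕ} (G : Graph n) where
  open Edges G

  ArcOn : (Ed → Set) → Ed → Fin n → Fin n → Set
  ArcOn Fwd e u v = (u ≡ s e × v ≡ t e × Fwd e) ⊎ (u ≡ t e × v ≡ s e × ¬ Fwd e)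

  Arc : (Ed → Set) → Fin n → Fin n → Set
  Arc Fwd u v = Σ Ed λ e → ArcOn Fwd e u v

  arc-endpoints : ∀ {Fwd e u v} → ArcOn Fwd e u v → u ∈ₑ e × v ∈ₑ e
  arc-endpoints (inj₁ (p , q , _)) = at-s p , at-t q
  arc-endpoints (inj₂ (p , q , _)) = at-t p , at-s q

  -- Decidability of the choice is what makes every edge receive a direction.
  arc-orientation : ∀ {Fwd} → (∀ e → Dec (Fwd e)) → IsOrientation G (Arc Fwd)
  arc-orientation {Fwd} Fwd? = arcs-are-edges , total , antisymmetric
    where
      arcs-are-edges : ∀ u v → Arc Fwd u v → Adj G u v
      arcs-are-edges _ _ (e , inj₁ (refl , refl , _)) = s-adj-t e
      arcs-are-edges _ _ (e , inj₂ (refl , refl , _)) = Graph.sym G _ _ (s-adj-t e)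

      total : ∀ u v → Adj G u v → Arc Fwd u v ⊎ Arc Fwd v u
      total u v uv with edge-between uv
      ... | e , ue , ve with endpoints ue ve (adj⇒≢ uv) | Fwd? e
      ...   | inj₁ (p , q) | yes fwd = inj₁ (e , inj₁ (p , q , fwd))
      ...   | inj₁ (p , q) | no bwd  = inj₂ (e , inj₂ (q , p , bwd))
      ...   | inj₂ (p , q) | yes fwd = inj₂ (e , inj₁ (q , p , fwd))
      ...   | inj₂ (p , q) | no bwd  = inj₁ (e , inj₂ (p , q , bwd))

      opposite : ∀ {e u v} → u ≢ v → ArcOn Fwd e u v → ArcOn Fwd e v u → ⊥
      opposite u≢v (inj₁ (p , _ , _))   (inj₁ (p′ , _ , _))   = u≢v (trans p (sym p′))
      opposite _   (inj₁ (_ , _ , fwd)) (inj₂ (_ , _ , bwd))  = bwd fwd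
      opposite _   (inj₂ (_ , _ , bwd)) (inj₁ (_ , _ , fwd))  = bwd fwd
      opposite u≢v (inj₂ (p , _ , _))   (inj₂ (p′ , _ , _))   = u≢v (trans p (sym p′))

      antisymmetric : ∀ u v → Arc Fwd u v → Arc Fwd v u → ⊥
      antisymmetric u v (e , uv) (e′ , vu) =
        opposite u≢v uv (subst (λ x → ArcOn Fwd x v u) (sym e≡e′) vu)
        where
          u≢v : u ≢ v
          u≢v = adj⇒≢ (arcs-are-edges u v (e , uv))
          e≡e′ : e ≡ e′
          e≡e′ = edge-determined (proj₁ (arc-endpoints {Fwd} uv)) (proj₂ (arc-endpoints {Fwd} uv)) u≢v
                                 (proj₂ (arc-endpoints {Fwd} vu)) (proj₁ (arc-endpoints {Fwd} vu))

  arc-from-tail : ∀ {Fwd e u v} → u ∈ₑ e → v ∈ₑ e → u ≢ v →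
                  (u ≡ s e → Fwd e) → (u ≡ t e → ¬ Fwd e) → Arc Fwd u v
  arc-from-tail {e = e} ue ve u≢v fwd bwd with endpoints ue ve u≢v
  ... | inj₁ (p , q) = e , inj₁ (p , q , fwd p)
  ... | inj₂ (p , q) = e , inj₂ (p , q , bwd p)

module FromCliques {n : ℕ} (G : Graph n) (triangle-free : TriangleFree G) where
  open Edges G
  open ChosenOrientation G

  -- In a triangle-free graph a clique of L(G) containing the edge e meets e
  -- at one endpoint only: edges f ∋ s e and g ∋ t e of the clique would meet
  -- outside e and close a triangle.
  class-meets-one-end : ∀ {R} → IsEquivSubgraph L R → ∀ {e f g} →
                        R e f → R e g → s e ∈ₑ f → t e ∈ₑ g → ⊥
  class-meets-one-end (in-L , symmetric , transitive) {e} {f} {g} ef eg sf tg with f ≟ₑ g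
  ... | yes refl = proj₁ (in-L e f ef) (edge-determined (at-s refl) (at-t refl) (s≢t e) sf tg)
  ... | no f≢g with share⇒common (proj₂ (in-L f g (transitive f e g (symmetric e f ef) eg f≢g)))
  ...   | z , zf , zg with z ≟ s e | z ≟ t e
  ...     | yes refl | _ = proj₁ (in-L e g eg) (edge-determined (at-s refl) (at-t refl) (s≢t e) zg tg)
  ...     | no _ | yes refl = proj₁ (in-L e f ef) (edge-determined (at-s refl) (at-t refl) (s≢t e) sf zf)
  ...     | no z≢s | no z≢t =
    triangle-free (s e) (t e) z (s-adj-t e)
                  (endpoints-adjacent tg zg (z≢t ∘ sym)) (endpoints-adjacent sf zf (z≢s ∘ sym))

  -- Given an equivalence covering R of L(G), orientation i directs an edge e
  -- away from the endpoint at which class i reaches it.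
  module Orienting {k : ℕ} (R : Fin k → Ed → Ed → Set)
                   (classes : ∀ i → IsEquivSubgraph L (R i))
                   (covers : ∀ e f → E L e f → ∃[ i ] R i e f) where

    colourBy : ∀ e f → Dec (E L e f) → Maybe (Fin k)
    colourBy e f (yes ef) = just (proj₁ (covers e f ef))
    colourBy e f (no _)   = nothing

    colourBy-sound : ∀ {i} e f (d : Dec (E L e f)) → colourBy e f d ≡ just i → R i e f
    colourBy-sound e f (yes ef) refl = proj₂ (covers e f ef)
    colourBy-sound e f (no _)   ()

    colourBy-defined : ∀ e f (d : Dec (E L e f)) → E L e f → ∃[ i ] colourBy e f d ≡ just i
    colourBy-defined e f (yes _)  _  = _ , refl
    colourBy-defined e f (no ¬ef) ef = ⊥-elim (¬ef ef)

    colour : Ed → Ed → Maybe (Fin k)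
    colour e f = colourBy e f (L-adjacent? e f)

    -- The pair {e, f} was assigned to class i: a decidable, symmetric
    -- refinement of R i that still covers L(G).
    Linked : Fin k → Ed → Ed → Set
    Linked i e f = colour e f ≡ just i ⊎ colour f e ≡ just i

    linked⇒class : ∀ {i e f} → Linked i e f → R i e f
    linked⇒class {e = e} {f} (inj₁ c) = colourBy-sound e f _ c
    linked⇒class {i} {e} {f} (inj₂ c) = proj₁ (proj₂ (classes i)) f e (colourBy-sound f e _ c)

    LinkedAt : Fin k → Ed → Fin n → Set
    LinkedAt i e x = Σ Ed λ f → x ∈ₑ f × Linked i e f

    linkedAt? : ∀ i e x → Dec (LinkedAt i e x)
    linkedAt? i e x = any-edge? _ λ f →
      (x ∈ₑ? f) ×-dec (≡-dec-Maybe _≟_ (colour e f) (just i) ⊎-dec ≡-dec-Maybe _≟_ (colour f e) (just i))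

    linked-at-one-end : ∀ {i e} → LinkedAt i e (s e) → LinkedAt i e (t e) → ⊥
    linked-at-one-end {i} (_ , sf , ef) (_ , tg , eg) =
      class-meets-one-end (classes i) (linked⇒class ef) (linked⇒class eg) sf tg

    Orient : Fin k → Fin n → Fin n → Set
    Orient i = Arc (λ e → LinkedAt i e (s e))

    orient-is-orientation : ∀ i → IsOrientation G (Orient i)
    orient-is-orientation i = arc-orientation (λ e → linkedAt? i e (s e))

    orient-away : ∀ {i e u v} → LinkedAt i e u → u ∈ₑ e → v ∈ₑ e → u ≢ v → Orient i u v
    orient-away {i} {e} at-u ue ve u≢v =
      arc-from-tail ue ve u≢v (λ u≡s → subst (LinkedAt i e) u≡s at-u)
                              (λ u≡t at-s → linked-at-one-end at-s (subst (LinkedAt i e) u≡t at-u))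

    orient-covers : ∀ u v w → Adj G u v → Adj G u w → v ≢ w → ∃[ i ] (Orient i u v × Orient i u w)
    orient-covers u v w uv uw v≢w with edge-between uv | edge-between uw
    ... | e , ue , ve | f , uf , wf
      with colourBy-defined e f (L-adjacent? e f)
             (fan-distinct ue ve uf wf (adj⇒≢ uv) (adj⇒≢ uw) v≢w , common⇒share ue uf)
    ...   | i , c = i , orient-away (f , uf , inj₁ c) ue ve (adj⇒≢ uv)
                      , orient-away (e , ue , inj₂ c) uf wf (adj⇒≢ uw)

eq-cover⇒orientation-cover : ∀ {n} (G : Graph n) → TriangleFree G → ∀ {k} →
                             HasEqCover (LineGraph G) k → HasOrientationCover G k
eq-cover⇒orientation-cover G triangle-free (R , classes , covers) =
  Orient , orient-is-orientation , orient-covers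
  where open FromCliques.Orienting G triangle-free R classes covers

proposition3 : ∀ {n} (G : Graph n) → TriangleFree G → ∀ (m : ℕ) → (IsEqNumber (LineGraph G) m → IsSigma G m) × (IsSigma G m → IsEqNumber (LineGraph G) m)
proposition3 G triangle-free m =
  minimum-transfer eq⇒σ σ⇒eq m , minimum-transfer σ⇒eq eq⇒σ m
  where
    eq⇒σ : ∀ k → HasEqCover (LineGraph G) k → HasOrientationCover G k
    eq⇒σ k = eq-cover⇒orientation-cover G triangle-free
    σ⇒eq : ∀ k → HasOrientationCover G k → HasEqCover (LineGraph G) k
    σ⇒eq k = orientation-cover⇒eq-cover G
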